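{- Let $n\ge1$, $x,y$ coprime with $1\le x<y$, and consider the rotor multigraph $P^{x,y}_n$. If $(\rho,\sigma)$ and $(\rho',\sigma')$ are rotor-particle configurations with $(\rho,\sigma)\sim(\rho',\sigma')$, then $g(\rho)-h(\sigma)=g(\rho')-h(\sigma')$.
   Context: $P^{x,y}_n$ has vertices $u_0,\dots,u_{n+1}$; $u_0,u_{n+1}$ are sinks and $V_0=\{u_1,\dots,u_n\}$. For $1\le k\le n$, $u_k$ has outgoing arcs $a^k_0,\dots,a^k_{x+y-1}$, with $a^k_i$ going to $u_{k+1}$ for $0\le i\le x-1$ and to $u_{k-1}$ for $x\le i\le x+y-1$; rotor order $\theta(a^k_i)=a^k_{(i+1)\bmod(x+y)}$. A rotor configuration assigns to each $u\in V_0$ an outgoing arc $\rho(u)$; a particle configuration is a map $\sigma:\{u_0,\dots,u_{n+1}\}\to\mathbb{Z}$ (a vertex $u$ identified with the configuration with one particle on $u$). For $u\in V_0$, $\mathrm{routing}^+_u(\rho,\sigma)=(\rho',\sigma+\mathrm{head}(\rho(u))-u)$ where $\rho'$ equals $\rho$ except $\rho'(u)=\theta(\rho(u))$; these are commuting bijections; for $r:V_0\to\mathbb{Z}$, $\mathrm{routing}^r$ composes the $(\mathrm{routing}^+_u)^{r(u)}$ (negative powers = inverses); $(\rho,\sigma)\sim(\rho',\sigma')$ iff $\mathrm{routing}^r(\rho,\sigma)=(\rho',\sigma')$ for some $r$. $h$ is linear on particle configurations with $h(u_0)=0$ and $h(u_k)=\sum_{i=0}^{k-1}x^{n-i}y^i$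 ($1\le k\le n+1$). $g(a^k_j)=\sum_{i=0}^{j-1}\big(h(\mathrm{head}(a^k_i))-h(u_k)\big)$ and $g(\rho)=\sum_{u\in V_0}g(\rho(u))$. -}

module Defs where

open import Data.Nat as ℕ using (ℕ; zero; suc; _∸_; _^_; _<ᵇ_)
open import Data.Fin as Fin using (Fin; zero; suc; toℕ; inject₁; fromℕ; _≟_)
open import Data.Integer as ℤ using (ℤ; +_; -[1+_]; _+_; _-_; _*_; 0ℤ; 1ℤ; -1ℤ)
open import Data.Product using (Σ; _×_; _,_; proj₁; proj₂)
open import Data.Bool using (if_then_else_)
open import Relation.Nullary using (yes; no)
open import Relation.Binary.PropositionalEquality using (_≡_)

sucMod : ∀ {m} → Fin m → Fin m
sucMod {suc zero} _ = zero
sucMod {suc (suc m)} zero = suc zero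
sucMod {suc (suc m)} (suc i) with sucMod {suc m} i
... | zero = zero
... | suc j = suc (suc j)

predMod : ∀ {m} → Fin m → Fin m
predMod {suc m} zero = fromℕ m
predMod {suc m} (suc i) = inject₁ i

sumℕ : ℕ → (ℕ → ℤ) → ℤ
sumℕ zero f = 0ℤ
sumℕ (suc k) f = sumℕ k f + f k

sumFin : ∀ m → (Fin m → ℤ) → ℤ
sumFin zero f = 0ℤ
sumFin (suc m) f = f zero + sumFin m (λ i → f (suc i))

-- Vertices u_0..u_{n+1} are Fin (2 + n) (index = toℕ).
-- Non-sink vertices V_0 = {u_1..u_n} are indexed by k : Fin n, standing for u_{k+1}.
module P (n x y : ℕ) where

  Vertex : Set
  Vertex = Fin (suc (suc n))

  V₀ : Set
  V₀ = Fin n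

  Arc : Set
  Arc = Fin (x ℕ.+ y)

  vtx : V₀ → Vertex
  vtx k = suc (inject₁ k)

  right : V₀ → Vertex
  right k = suc (suc k)

  left : V₀ → Vertex
  left k = inject₁ (inject₁ k)

  headℕ : V₀ → ℕ → Vertex
  headℕ k i = if i <ᵇ x then right k else left k

  head : V₀ → Arc → Vertex
  head k a = headℕ k (toℕ a)

  θ : Arc → Arc
  θ = sucMod

  θ⁻¹ : Arc → Arc
  θ⁻¹ = predMod

  Rotor : Set
  Rotor = V₀ → Arc

  Particles : Set
  Particles = Vertex → ℤ

  Config : Set
  Config = Rotor × Particles

  addAt : Vertex → ℤ → Particles → Particles
  addAt v c σ w with w ≟ v
  ... | yes _ = σ w + c
  ... | no _ = σ w

  updRotor : V₀ → Arc → Rotor → Rotor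
  updRotor u a ρ w with w ≟ u
  ... | yes _ = a
  ... | no _ = ρ w

  routing⁺ : V₀ → Config → Config
  routing⁺ u (ρ , σ) =
    updRotor u (θ (ρ u)) ρ , addAt (vtx u) -1ℤ (addAt (head u (ρ u)) 1ℤ σ)

  routing⁻ : V₀ → Config → Config
  routing⁻ u (ρ , σ) =
    updRotor u (θ⁻¹ (ρ u)) ρ , addAt (head u (θ⁻¹ (ρ u))) -1ℤ (addAt (vtx u) 1ℤ σ)

  iter : ℕ → (Config → Config) → Config → Config
  iter zero f c = c
  iter (suc m) f c = f (iter m f c)

  routingPow : V₀ → ℤ → Config → Config
  routingPow u (+ m) = iter m (routing⁺ u)
  routingPow u -[1+ m ] = iter (suc m) (routing⁻ u)

  routingAll : ∀ m → (Fin m → V₀) → (V₀ → ℤ) → Config → Config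
  routingAll zero us r c = c
  routingAll (suc m) us r c =
    routingPow (us zero) (r (us zero)) (routingAll m (λ i → us (suc i)) r c)

  routing : (V₀ → ℤ) → Config → Config
  routing r = routingAll n (λ u → u) r

  _≈_ : Config → Config → Set
  (ρ , σ) ≈ (ρ' , σ') = (∀ u → ρ u ≡ ρ' u) × (∀ v → σ v ≡ σ' v)

  _∼_ : Config → Config → Set
  c ∼ c' = Σ (V₀ → ℤ) (λ r → routing r c ≈ c')

  hV : Vertex → ℤ
  hV v = sumℕ (toℕ v) (λ i → + (x ^ (n ∸ i) ℕ.* y ^ i))

  h : Particles → ℤ
  h σ = sumFin (suc (suc n)) (λ v → σ v * hV v)

  gArc : V₀ → Arc → ℤ
  gArc k a = sumℕ (toℕ a) (λ i → hV (headℕ k i) - hV (vtx k))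

  g : Rotor → ℤ
  g ρ = sumFin n (λ u → gArc u (ρ u))

{-# OPTIONS --safe #-}
module Submission where

-- One routing step at u turns the rotor of u one notch, so g grows by
-- h(head ρ(u)) − h(u), and moves a particle from u to head ρ(u), so h grows by
-- the same amount: g − h is unchanged. The exception is the notch closing a full
-- turn, where g drops back to 0; it is harmless because a full turn of the
-- rotor at u_{k+1} contributes x·w_{k+1} − y·w_k = 0 with w_i = x^{n−i} y^i,
-- the weights whose partial sums define h.

open import Defs
open import Data.Nat as ℕ using (ℕ; zero; suc; _∸_; _^_; _<ᵇ_; _≤_; _<_)
import Data.Nat.Properties as ℕ
import Data.Nat.Tactic.RingSolver as ℕ-Solver
open import Data.Nat.Coprimality using (Coprime)
open import Data.Fin using (Fin; zero; suc; toℕ; inject₁; fromℕ; _≟_)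
import Data.Fin.Properties as Fin
open import Data.Integer using (ℤ; +_; -[1+_]; _+_; _-_; _*_; -_; 0ℤ; 1ℤ; -1ℤ)
import Data.Integer.Properties as ℤ
open import Data.Integer.Tactic.RingSolver using (solve-∀)
open import Data.Bool using (true; false; T)
open import Data.Product using (_×_; _,_)
open import Data.Sum using (_⊎_; inj₁; inj₂)
open import Data.Empty using (⊥-elim)
open import Relation.Nullary using (yes; no; ¬_)
open import Relation.Binary.PropositionalEquality

sumFin-cong : ∀ m {f f' : Fin m → ℤ} → (∀ i → f i ≡ f' i) → sumFin m f ≡ sumFin m f'
sumFin-cong zero    f≗f' = refl
sumFin-cong (suc m) f≗f' = cong₂ _+_ (f≗f' zero) (sumFin-cong m (λ i → f≗f' (suc i)))

sumFin-update : ∀ m (f f' : Fin m → ℤ) (u : Fin m) → (∀ i → ¬ i ≡ u → f i ≡ f' i) →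
  sumFin m f ≡ sumFin m f' + (f u - f' u)
sumFin-update (suc m) f f' zero f≗f'
  rewrite sumFin-cong m (λ i → f≗f' (suc i) (λ ()))
  = shuffle (f zero) (f' zero) (sumFin m (λ i → f' (suc i)))
  where
  shuffle : ∀ a b s → a + s ≡ b + s + (a - b)
  shuffle = solve-∀
sumFin-update (suc m) f f' (suc u) f≗f'
  rewrite f≗f' zero (λ ())
        | sumFin-update m (λ i → f (suc i)) (λ i → f' (suc i)) u
            (λ i i≢u → f≗f' (suc i) (λ eq → i≢u (Fin.suc-injective eq)))
  = sym (ℤ.+-assoc (f' zero) _ _)

sumℕ-+ : ∀ a b (f : ℕ → ℤ) → sumℕ (a ℕ.+ b) f ≡ sumℕ a f + sumℕ b (λ i → f (a ℕ.+ i))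
sumℕ-+ a zero    f rewrite ℕ.+-identityʳ a = sym (ℤ.+-identityʳ _)
sumℕ-+ a (suc b) f rewrite ℕ.+-suc a b | sumℕ-+ a b f = ℤ.+-assoc (sumℕ a f) _ _

sumℕ-const : ∀ m (f : ℕ → ℤ) c → (∀ i → i < m → f i ≡ c) → sumℕ m f ≡ + m * c
sumℕ-const zero    f c f≡c = sym (ℤ.*-zeroˡ c)
sumℕ-const (suc m) f c f≡c
  rewrite sumℕ-const m f c (λ i i<m → f≡c i (ℕ.m<n⇒m<1+n i<m)) | f≡c m ℕ.≤-refl
  = distrib (+ m) c
  where
  distrib : ∀ a c → a * c + c ≡ (1ℤ + a) * c
  distrib = solve-∀

sucMod-toℕ : ∀ {m} (a : Fin m) →
  toℕ (sucMod a) ≡ suc (toℕ a) ⊎ (toℕ (sucMod a) ≡ 0 × suc (toℕ a) ≡ m)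
sucMod-toℕ {suc zero}    zero = inj₂ (refl , refl)
sucMod-toℕ {suc (suc m)} zero = inj₁ refl
sucMod-toℕ {suc (suc m)} (suc i) with sucMod {suc m} i | sucMod-toℕ {suc m} i
... | zero  | inj₁ ()
... | zero  | inj₂ (_ , wraps) = inj₂ (refl , cong suc wraps)
... | suc j | inj₁ steps       = inj₁ (cong suc steps)
... | suc j | inj₂ (() , _)

sucMod-predMod : ∀ {m} (a : Fin m) → sucMod (predMod a) ≡ a
sucMod-predMod {suc m} zero with sucMod-toℕ (fromℕ m)
... | inj₁ steps = ⊥-elim (ℕ.<-irrefl refl
        (subst (_< suc m) (trans steps (cong suc (Fin.toℕ-fromℕ m))) (Fin.toℕ<n (sucMod (fromℕ m)))))
... | inj₂ (wraps , _) = Fin.toℕ-injective wraps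
sucMod-predMod {suc m} (suc i) with sucMod-toℕ (inject₁ i)
... | inj₁ steps      = Fin.toℕ-injective (trans steps (cong suc (Fin.toℕ-inject₁ i)))
... | inj₂ (_ , full) = ⊥-elim (Fin.toℕ-inject₁-≢ i (sym (ℕ.suc-injective full)))

module Potential (n x y : ℕ) where
  open P n x y

  updRotor-same : ∀ u a (ρ : Rotor) → updRotor u a ρ u ≡ a
  updRotor-same u a ρ with u ≟ u
  ... | yes _   = refl
  ... | no u≢u = ⊥-elim (u≢u refl)

  updRotor-other : ∀ u a (ρ : Rotor) v → ¬ v ≡ u → updRotor u a ρ v ≡ ρ v
  updRotor-other u a ρ v v≢u with v ≟ u
  ... | yes v≡u = ⊥-elim (v≢u v≡u)
  ... | no _    = refl

  addAt-same : ∀ v c (σ : Particles) → addAt v c σ v ≡ σ v + c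
  addAt-same v c σ with v ≟ v
  ... | yes _   = refl
  ... | no v≢v = ⊥-elim (v≢v refl)

  addAt-other : ∀ v c (σ : Particles) w → ¬ w ≡ v → addAt v c σ w ≡ σ w
  addAt-other v c σ w w≢v with w ≟ v
  ... | yes w≡v = ⊥-elim (w≢v w≡v)
  ... | no _    = refl

  weight : ℕ → ℤ
  weight i = + (x ^ (n ∸ i) ℕ.* y ^ i)

  x*weight-suc≡y*weight : ∀ k → k < n → + x * weight (suc k) ≡ + y * weight k
  x*weight-suc≡y*weight k k<n
    rewrite ℕ.+-∸-assoc 1 k<n
    = trans (sym (ℤ.pos-* x _))
        (trans (cong +_ (swap x y (x ^ (n ∸ suc k)) (y ^ k))) (ℤ.pos-* y _))
    where
    swap : ∀ x y a b → x ℕ.* (a ℕ.* (y ℕ.* b)) ≡ y ℕ.* ((x ℕ.* a) ℕ.* b)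
    swap = ℕ-Solver.solve-∀

  hV-left : ∀ k → hV (left k) ≡ sumℕ (toℕ k) weight
  hV-left k rewrite Fin.toℕ-inject₁ (inject₁ k) | Fin.toℕ-inject₁ k = refl

  hV-vtx : ∀ k → hV (vtx k) ≡ sumℕ (toℕ k) weight + weight (toℕ k)
  hV-vtx k rewrite Fin.toℕ-inject₁ k = refl

  hV-right : ∀ k → hV (right k) ≡ hV (vtx k) + weight (suc (toℕ k))
  hV-right k rewrite hV-vtx k = refl

  headℕ-< : ∀ k i → i < x → headℕ k i ≡ right k
  headℕ-< k i i<x with i <ᵇ x in eq
  ... | true  = refl
  ... | false = ⊥-elim (subst T eq (ℕ.<⇒<ᵇ i<x))

  headℕ-x+ : ∀ k i → headℕ k (x ℕ.+ i) ≡ left k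
  headℕ-x+ k i with x ℕ.+ i <ᵇ x in eq
  ... | false = refl
  ... | true  = ⊥-elim (ℕ.m+n≮m x i (ℕ.<ᵇ⇒< _ _ (subst T (sym eq) _)))

  Δh : V₀ → ℕ → ℤ
  Δh k i = hV (headℕ k i) - hV (vtx k)

  Δh-< : ∀ k i → i < x → Δh k i ≡ weight (suc (toℕ k))
  Δh-< k i i<x rewrite headℕ-< k i i<x | hV-right k = cancel (hV (vtx k)) _
    where
    cancel : ∀ a b → a + b - a ≡ b
    cancel = solve-∀

  Δh-x+ : ∀ k i → Δh k (x ℕ.+ i) ≡ - weight (toℕ k)
  Δh-x+ k i rewrite headℕ-x+ k i | hV-left k | hV-vtx k = cancel (sumℕ (toℕ k) weight) _
    where
    cancel : ∀ s a → s - (s + a) ≡ - a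
    cancel = solve-∀

  sumℕ-Δh-fullTurn : ∀ k → sumℕ (x ℕ.+ y) (Δh k) ≡ 0ℤ
  sumℕ-Δh-fullTurn k
    rewrite sumℕ-+ x y (Δh k)
          | sumℕ-const x (Δh k) (weight (suc (toℕ k))) (Δh-< k)
          | sumℕ-const y (λ i → Δh k (x ℕ.+ i)) (- weight (toℕ k)) (λ i _ → Δh-x+ k i)
          | sym (ℤ.neg-distribʳ-* (+ y) (weight (toℕ k)))
          | x*weight-suc≡y*weight (toℕ k) (Fin.toℕ<n k)
    = ℤ.+-inverseʳ (+ y * weight (toℕ k))

  gArc-θ : ∀ k a → gArc k (θ a) ≡ gArc k a + Δh k (toℕ a)
  gArc-θ k a with sucMod-toℕ a
  ... | inj₁ steps rewrite steps = refl
  ... | inj₂ (wraps , full) rewrite wraps =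
    sym (trans (cong (λ m → sumℕ m (Δh k)) full) (sumℕ-Δh-fullTurn k))

  g-updRotor : ∀ u a ρ → g (updRotor u a ρ) ≡ g ρ + (gArc u a - gArc u (ρ u))
  g-updRotor u a ρ
    rewrite sumFin-update n (λ v → gArc v (updRotor u a ρ v)) (λ v → gArc v (ρ v)) u
              (λ v v≢u → cong (gArc v) (updRotor-other u a ρ v v≢u))
          | updRotor-same u a ρ
    = refl

  h-addAt : ∀ v c σ → h (addAt v c σ) ≡ h σ + c * hV v
  h-addAt v c σ
    rewrite sumFin-update (suc (suc n)) (λ w → addAt v c σ w * hV w) (λ w → σ w * hV w) v
              (λ w w≢v → cong (_* hV w) (addAt-other v c σ w w≢v))
          | addAt-same v c σ
    = cong (λ t → h σ + t) (distrib (σ v) c (hV v))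
    where
    distrib : ∀ s c k → (s + c) * k - s * k ≡ c * k
    distrib = solve-∀

  potential : Config → ℤ
  potential (ρ , σ) = g ρ - h σ

  potential-routing⁺ : ∀ u c → potential (routing⁺ u c) ≡ potential c
  potential-routing⁺ u (ρ , σ)
    rewrite g-updRotor u (θ (ρ u)) ρ
          | h-addAt (vtx u) -1ℤ (addAt (head u (ρ u)) 1ℤ σ)
          | h-addAt (head u (ρ u)) 1ℤ σ
          | gArc-θ u (ρ u)
    = balance (g ρ) (gArc u (ρ u)) (h σ) (hV (head u (ρ u))) (hV (vtx u))
    where
    balance : ∀ G a H t s → G + (a + (t - s) - a) - (H + 1ℤ * t + -1ℤ * s) ≡ G - H
    balance = solve-∀

  potential-routing⁻ : ∀ u c → potential (routing⁻ u c) ≡ potential c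
  potential-routing⁻ u (ρ , σ)
    rewrite g-updRotor u (θ⁻¹ (ρ u)) ρ
          | h-addAt (head u (θ⁻¹ (ρ u))) -1ℤ (addAt (vtx u) 1ℤ σ)
          | h-addAt (vtx u) 1ℤ σ
          | trans (cong (gArc u) (sym (sucMod-predMod (ρ u)))) (gArc-θ u (θ⁻¹ (ρ u)))
    = balance (g ρ) (gArc u (θ⁻¹ (ρ u))) (h σ) (hV (head u (θ⁻¹ (ρ u)))) (hV (vtx u))
    where
    balance : ∀ G b H t s → G + (b - (b + (t - s))) - (H + 1ℤ * s + -1ℤ * t) ≡ G - H
    balance = solve-∀

  potential-resp-≈ : ∀ c c' → c ≈ c' → potential c ≡ potential c'
  potential-resp-≈ (ρ , σ) (ρ' , σ') (ρ≗ρ' , σ≗σ') =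
    cong₂ _-_ (sumFin-cong n (λ u → cong (gArc u) (ρ≗ρ' u)))
              (sumFin-cong (suc (suc n)) (λ v → cong (_* hV v) (σ≗σ' v)))

  ∼-invariant : (F : Config → ℤ) →
    (∀ u c → F (routing⁺ u c) ≡ F c) → (∀ u c → F (routing⁻ u c) ≡ F c) →
    (∀ c c' → c ≈ c' → F c ≡ F c') →
    ∀ c c' → c ∼ c' → F c ≡ F c'
  ∼-invariant F F-routing⁺ F-routing⁻ F-resp-≈ c c' (r , routed≈c') =
    trans (sym (F-routingAll n (λ u → u) c)) (F-resp-≈ _ c' routed≈c')
    where
    F-iter : ∀ m f → (∀ c → F (f c) ≡ F c) → ∀ c → F (iter m f c) ≡ F c
    F-iter zero    f F-f c = refl
    F-iter (suc m) f F-f c = trans (F-f _) (F-iter m f F-f c)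

    F-routingPow : ∀ u z c → F (routingPow u z c) ≡ F c
    F-routingPow u (+ m)    = F-iter m (routing⁺ u) (F-routing⁺ u)
    F-routingPow u -[1+ m ] = F-iter (suc m) (routing⁻ u) (F-routing⁻ u)

    F-routingAll : ∀ m us c → F (routingAll m us r c) ≡ F c
    F-routingAll zero    us c = refl
    F-routingAll (suc m) us c =
      trans (F-routingPow (us zero) (r (us zero)) _) (F-routingAll m (λ i → us (suc i)) c)

proposition8 : (n x y : ℕ) → 1 ≤ n → Coprime x y → 1 ≤ x → x < y →
    (ρ ρ' : P.Rotor n x y) (σ σ' : P.Particles n x y) →
    P._∼_ n x y (ρ , σ) (ρ' , σ') →
    P.g n x y ρ - P.h n x y σ ≡ P.g n x y ρ' - P.h n x y σ'
proposition8 n x y _ _ _ _ ρ ρ' σ σ' =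
  ∼-invariant potential potential-routing⁺ potential-routing⁻ potential-resp-≈ (ρ , σ) (ρ' , σ')
  where open Potential n x y
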